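{- Let $\mathcal M=(D,M)$ be a $\mathrm{3LQST_0}$-interpretation, $D^*\subseteq D$, $d^*\in D^*$, $\mathcal V_0'\subseteq\mathcal V_0$, $\mathcal V_1'\subseteq\mathcal V_1$, $l>0$, and $\mathcal M^*=(D^*,M^*)=\mathrm{Rel}(\mathcal M,D^*,d^*,\mathcal V_0',\mathcal V_1',l)$. Let $\psi_0$ be an atom $x=y$ or $x\in X$ ($x,y\in\mathcal V_0$, $X\in\mathcal V_1$); let $\psi_0'$ be an atom $\{x_1,\dots,x_k\}=X$ or $\{x_1,\dots,x_k\}\in A$ ($x_i\in\mathcal V_0$, $X\in\mathcal V_1$, $A\in\mathcal V_2$, $k\le l$); let $\psi_1$ be an atom $X=Y$ or $X\in A$ with $X,Y\in\mathcal V_1'$, $A\in\mathcal V_2$. Then: (a) if $Mx\in D^*$ for every $x\in\mathcal V_0$ in $\psi_0$, then $\mathcal M\models\psi_0$ iff $\mathcal M^*\models\psi_0$; (b) if (b1) $Mx\in D^*$ for every $x\in\mathcal V_0$ in $\psi_0'$, (b2) for every $X\in\mathcal V_1'$, $M^*X=MX$ when $|MX|\le l$ and $|M^*X|>l$ otherwise, and (b3) $M^*X=MX$ for every $X$ occurring in $\psi_0'$ with $X\in\mathcal V_1\setminus\mathcal V_1'$, then $\mathcal M\models\psi_0'$ iff $\mathcal M^*\models\psi_0'$; (c) if (c1) for every $X\in\mathcal V_1'$, $M^*X=MX$ when $|MX|\le l$ and $|M^*X|>l$ otherwise, and (c2) $(MX\mathbin{\Delta}MY)\cap D^*\ne\emptyset$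 for all $X,Y\in\mathcal V_1'$ with $MX\ne MY$, then $\mathcal M\models\psi_1$ iff $\mathcal M^*\models\psi_1$.
   Context: Variables: $\mathcal V_0$ (individual), $\mathcal V_1$ (set), $\mathcal V_2$ (collection). A $\mathrm{3LQST_0}$-interpretation is $(D,M)$ with $D\ne\emptyset$, $Mx\in D$, $MX\subseteq D$, $MA\subseteq\mathrm{pow}(D)$; the finite enumeration $\{x_1,\dots,x_k\}$ denotes $\{Mx_1,\dots,Mx_k\}$, and $=$, $\in$ have their standard meaning. $\Delta$ is symmetric difference. Relativized interpretation: $\mathrm{Rel}(\mathcal M,D^*,d^*,\mathcal V_0',\mathcal V_1',l)=(D^*,M^*)$ where $M^*x=Mx$ if $Mx\in D^*$, else $M^*x=d^*$; $M^*X=MX\cap D^*$; $M^*A=\big((MA\cap\mathrm{pow}(D^*))\setminus(\{M^*X:X\in\mathcal V_1'\}\cup\mathrm{pow}_{\le l}(S))\big)\cup\{M^*X:X\in\mathcal V_1',MX\in MA\}\cup(\mathrm{pow}_{\le l}(S)\cap MA)$, where $S=\{M^*x:x\in\mathcal V_0'\}$ and $\mathrm{pow}_{\le l}(S)$ is the set of subsets of $S$ with at most $l$ elements. -}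

module Defs where

open import Data.Nat using (ℕ; _≤_; _<_)
open import Data.List using (List; []; _∷_; length; map)
open import Data.List.Membership.Propositional using (_∈_)
open import Data.List.Relation.Unary.All using (All)
open import Data.Product using (Σ; ∃; _×_; _,_)
open import Data.Sum using (_⊎_)
open import Relation.Nullary using (¬_; Dec; yes; no)
open import Relation.Binary.PropositionalEquality using (_≡_)
open import Function.Bundles using (_⇔_)

-- Variables of each sort are indexed by natural numbers:
-- individual variables x : ℕ (V0), set variables X : ℕ (V1),
-- collection variables A : ℕ (V2).

Subset : Set → Set₁
Subset U = U → Set

_⊆_ : {U : Set} → Subset U → Subset U → Set
S ⊆ T = ∀ u → S u → T u

_≐_ : {U : Set} → Subset U → Subset U → Set
S ≐ T = ∀ u → (S u → T u) × (T u → S u)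

-- |S| ≤ l : S is covered by a list of length ≤ l
AtMost : {U : Set} → ℕ → Subset U → Set
AtMost {U} l S = Σ (List U) λ us → length us ≤ l × (∀ u → S u → u ∈ us)

MoreThan : {U : Set} → ℕ → Subset U → Set
MoreThan l S = ¬ AtMost l S

-- An interpretation (D,M) over an ambient type U: the domain D is a subset of U.
record Interp (U : Set) : Set₁ where
  field
    dom : Subset U
    vx  : ℕ → U
    vX  : ℕ → Subset U
    vA  : ℕ → Subset U → Set
open Interp public

-- (D,M) is a 3LQST0-interpretation: D ≠ ∅, Mx ∈ D, MX ⊆ D, MA ⊆ pow(D);
-- MA is a set of sets, hence membership in it is extensional.
Is3LQST0 : {U : Set} → Interp U → Set₁
Is3LQST0 M =
  (∃ λ u → dom M u)
  × (∀ x → dom M (vx M x))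
  × (∀ X → vX M X ⊆ dom M)
  × (∀ A (T : Subset _) → vA M A T → T ⊆ dom M)
  × (∀ A (T T' : Subset _) → T ≐ T' → vA M A T → vA M A T')

-- The relativized interpretation Rel(M, D*, d*, V0', V1', l).
-- `dec` decides membership in D* (needed to define M* x by cases).
module Relativize {U : Set} (M : Interp U) (D* : Subset U)
                  (dec : ∀ u → Dec (D* u)) (d* : U)
                  (V0' V1' : ℕ → Set) (l : ℕ) where

  M*x : ℕ → U
  M*x x with dec (vx M x)
  ... | yes _ = vx M x
  ... | no  _ = d*

  M*X : ℕ → Subset U
  M*X X u = vX M X u × D* u

  Sset : Subset U
  Sset u = ∃ λ x → V0' x × u ≡ M*x x

  Pow≤ : Subset U → Set
  Pow≤ T = T ⊆ Sset × AtMost l T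

  M*A : ℕ → Subset U → Set
  M*A A T =
      (vA M A T × T ⊆ D* × ¬ (∃ λ X → V1' X × T ≐ M*X X) × ¬ Pow≤ T)
    ⊎ (∃ λ X → V1' X × T ≐ M*X X × vA M A (vX M X))
    ⊎ (Pow≤ T × vA M A T)

  Rel : Interp U
  Rel = record { dom = D* ; vx = M*x ; vX = M*X ; vA = M*A }

data Atom0 : Set where
  eq0  : ℕ → ℕ → Atom0
  mem0 : ℕ → ℕ → Atom0

data Atom0' : Set where
  enumEq : List ℕ → ℕ → Atom0'
  enumIn : List ℕ → ℕ → Atom0'

data Atom1 : Set where
  eq1  : ℕ → ℕ → Atom1
  mem1 : ℕ → ℕ → Atom1

vars0 : Atom0 → List ℕ
vars0 (eq0 x y) = x ∷ y ∷ []
vars0 (mem0 x X) = x ∷ []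

vars0' : Atom0' → List ℕ
vars0' (enumEq xs X) = xs
vars0' (enumIn xs A) = xs

enumLen : Atom0' → ℕ
enumLen (enumEq xs X) = length xs
enumLen (enumIn xs A) = length xs

setVars0' : Atom0' → List ℕ
setVars0' (enumEq xs X) = X ∷ []
setVars0' (enumIn xs A) = []

setVars1 : Atom1 → List ℕ
setVars1 (eq1 X Y) = X ∷ Y ∷ []
setVars1 (mem1 X A) = X ∷ []

enumSet : {U : Set} → Interp U → List ℕ → Subset U
enumSet M xs u = u ∈ map (vx M) xs

sat0 : {U : Set} → Interp U → Atom0 → Set
sat0 M (eq0 x y) = vx M x ≡ vx M y
sat0 M (mem0 x X) = vX M X (vx M x)

sat0' : {U : Set} → Interp U → Atom0' → Set
sat0' M (enumEq xs X) = enumSet M xs ≐ vX M X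
sat0' M (enumIn xs A) = vA M A (enumSet M xs)

sat1 : {U : Set} → Interp U → Atom1 → Set
sat1 M (eq1 X Y) = vX M X ≐ vX M Y
sat1 M (mem1 X A) = vA M A (vX M X)

_Δ_ : {U : Set} → Subset U → Subset U → Subset U
(S Δ T) u = (S u × ¬ T u) ⊎ (T u × ¬ S u)

-- The proof compares the three sorts of M* with those of M separately.
--   * Individuals: M* x = M x whenever M x ∈ D*, so enumerations of such
--     variables denote the same set in M and M* (and that set lies inside D*).
--   * Sets: M* X = M X ∩ D*.  Under (b2)/(c1) a V1'-variable whose M*-value
--     has at most l elements keeps its M-value ("small values are faithful"),
--     and under (c2) distinct M-values of V1'-variables stay distinct in M*.
--   * Collections: M* A is built from M A by a three-way case split; a set
--     T ⊆ D* in M A lands in M* A provided every V1'-variable representing T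
--     in M* carries T already in M.
-- Parts (a), (b), (c) are then case analyses on the atom, combining these
-- facts with the extensionality of collections in a 3LQST0-interpretation.
module Submission where

open import Defs
open import Data.Nat using (ℕ; _≤_; _<_)
open import Data.List using (List; []; _∷_; map; length)
open import Data.List.Properties using (length-map)
open import Data.List.Relation.Unary.All using (All; []; _∷_)
open import Data.List.Relation.Unary.Any using (here; there)
open import Data.List.Membership.Propositional using (_∈_)
open import Data.Product using (∃; _×_; _,_; proj₁; proj₂)
open import Data.Sum using (inj₁; inj₂)
open import Data.Empty using (⊥-elim)
open import Relation.Nullary using (¬_; Dec; yes; no)
open import Relation.Binary.PropositionalEquality
  using (_≡_; refl; subst; sym; trans; cong₂)
open import Function.Bundles using (_⇔_; mk⇔)

≐-refl : {U : Set} {S : Subset U} → S ≐ S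
≐-refl u = (λ s → s) , (λ s → s)

≐-sym : {U : Set} {S T : Subset U} → S ≐ T → T ≐ S
≐-sym e u = proj₂ (e u) , proj₁ (e u)

≐-trans : {U : Set} {S T R : Subset U} → S ≐ T → T ≐ R → S ≐ R
≐-trans e f u = (λ s → proj₁ (f u) (proj₁ (e u) s))
              , (λ r → proj₂ (e u) (proj₂ (f u) r))

AtMost-resp : {U : Set} {l : ℕ} {S T : Subset U} → T ≐ S → AtMost l S → AtMost l T
AtMost-resp e (us , len , cover) = us , len , λ u t → cover u (proj₁ (e u) t)

enumSet-AtMost : {U : Set} (N : Interp U) (l : ℕ) (xs : List ℕ)
  → length xs ≤ l → AtMost l (enumSet N xs)
enumSet-AtMost N l xs k≤l =
  map (vx N) xs , subst (_≤ l) (sym (length-map (vx N) xs)) k≤l , λ u p → p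

module Transfer (lem : (P : Set) → Dec P) {U : Set} (M : Interp U) (is : Is3LQST0 M)
  (D* : Subset U) (dec : ∀ u → Dec (D* u)) (d* : U)
  (V0' V1' : ℕ → Set) (l : ℕ) where
  open Relativize M D* dec d* V0' V1' l

  vA-resp : ∀ A (T T' : Subset U) → T ≐ T' → vA M A T → vA M A T'
  vA-resp = proj₂ (proj₂ (proj₂ (proj₂ is)))

  M*X-resp : ∀ X Y → vX M X ≐ vX M Y → M*X X ≐ M*X Y
  M*X-resp X Y e u = (λ { (x , d) → proj₁ (e u) x , d })
                   , (λ { (y , d) → proj₂ (e u) y , d })

  M*x-agrees : ∀ x → D* (vx M x) → M*x x ≡ vx M x
  M*x-agrees x d with dec (vx M x)
  ... | yes _ = refl
  ... | no ¬d = ⊥-elim (¬d d)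

  map-M*x-agrees : ∀ xs → All (λ x → D* (vx M x)) xs → map M*x xs ≡ map (vx M) xs
  map-M*x-agrees []       []       = refl
  map-M*x-agrees (x ∷ xs) (d ∷ ds) = cong₂ _∷_ (M*x-agrees x d) (map-M*x-agrees xs ds)

  enumSet-agrees : ∀ xs → All (λ x → D* (vx M x)) xs → enumSet Rel xs ≐ enumSet M xs
  enumSet-agrees xs ds u = subst (u ∈_) (map-M*x-agrees xs ds)
                         , subst (u ∈_) (sym (map-M*x-agrees xs ds))

  enumSet-⊆D* : ∀ xs → All (λ x → D* (vx M x)) xs → enumSet M xs ⊆ D*
  enumSet-⊆D* (x ∷ xs) (d ∷ ds) u (here refl) = d
  enumSet-⊆D* (x ∷ xs) (d ∷ ds) u (there p)   = enumSet-⊆D* xs ds u p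

  SizePreserving : Set
  SizePreserving = ∀ X → V1' X
    → (AtMost l (vX M X) → M*X X ≐ vX M X)
    × (¬ AtMost l (vX M X) → MoreThan l (M*X X))

  Separating : Set
  Separating = ∀ X Y → V1' X → V1' Y → ¬ (vX M X ≐ vX M Y)
    → ∃ λ u → (vX M X Δ vX M Y) u × D* u

  small-faithful : SizePreserving → ∀ X → V1' X → AtMost l (M*X X) → M*X X ≐ vX M X
  small-faithful sp X v small* with lem (AtMost l (vX M X))
  ... | yes small = proj₁ (sp X v) small
  ... | no ¬small = ⊥-elim (proj₂ (sp X v) ¬small small*)

  separated-injective : Separating → ∀ X Y → V1' X → V1' Y
    → M*X X ≐ M*X Y → vX M X ≐ vX M Y
  separated-injective sep X Y vX' vY' e with lem (vX M X ≐ vX M Y)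
  ... | yes same = same
  ... | no differ with sep X Y vX' vY' differ
  ...   | u , inj₁ (inX , ¬inY) , d = ⊥-elim (¬inY (proj₁ (proj₁ (e u) (inX , d))))
  ...   | u , inj₂ (inY , ¬inX) , d = ⊥-elim (¬inX (proj₁ (proj₂ (e u) (inY , d))))

  Represented : Subset U → Set
  Represented T = ∃ λ X → V1' X × T ≐ M*X X

  M*A-complete : ∀ A (T : Subset U) → T ⊆ D*
    → (∀ X → V1' X → T ≐ M*X X → T ≐ vX M X)
    → vA M A T → M*A A T
  M*A-complete A T T⊆D* faithful T∈A with lem (Pow≤ T)
  ... | yes pow = inj₂ (inj₂ (pow , T∈A))
  ... | no ¬pow with lem (Represented T)
  ...   | yes (X , v , e) = inj₂ (inj₁ (X , v , e , vA-resp A T (vX M X) (faithful X v e) T∈A))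
  ...   | no ¬rep         = inj₁ (T∈A , T⊆D* , ¬rep , ¬pow)

  part-a : ∀ (ψ : Atom0) → All (λ x → D* (vx M x)) (vars0 ψ) → sat0 M ψ ⇔ sat0 Rel ψ
  part-a (eq0 x y) (dx ∷ dy ∷ []) =
    mk⇔ (λ p → trans (M*x-agrees x dx) (trans p (sym (M*x-agrees y dy))))
        (λ q → trans (sym (M*x-agrees x dx)) (trans q (M*x-agrees y dy)))
  part-a (mem0 x X) (dx ∷ []) =
    mk⇔ (λ p → subst (vX M X) (sym (M*x-agrees x dx)) p , subst D* (sym (M*x-agrees x dx)) dx)
        (λ q → subst (vX M X) (M*x-agrees x dx) (proj₁ q))

  part-b : ∀ (ψ : Atom0') → enumLen ψ ≤ l
    → All (λ x → D* (vx M x)) (vars0' ψ)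
    → SizePreserving
    → All (λ X → ¬ V1' X → M*X X ≐ vX M X) (setVars0' ψ)
    → sat0' M ψ ⇔ sat0' Rel ψ
  part-b (enumEq xs X) k≤l ds sp (outside ∷ []) with lem (V1' X)
  ... | no ¬v = mk⇔ (λ p → ≐-trans E (≐-trans p (≐-sym (outside ¬v))))
                    (λ r → ≐-trans (≐-sym E) (≐-trans r (outside ¬v)))
    where E = enumSet-agrees xs ds
  ... | yes v = mk⇔ fwd bwd
    where
      E = enumSet-agrees xs ds
      -- In either model the equation makes the value of X small, hence faithful.
      fwd : enumSet M xs ≐ vX M X → enumSet Rel xs ≐ M*X X
      fwd p = ≐-trans E (≐-trans p (≐-sym (proj₁ (sp X v)
                (AtMost-resp (≐-sym p) (enumSet-AtMost M l xs k≤l)))))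
      bwd : enumSet Rel xs ≐ M*X X → enumSet M xs ≐ vX M X
      bwd r = ≐-trans (≐-sym E) (≐-trans r (small-faithful sp X v
                (AtMost-resp (≐-sym r) (enumSet-AtMost Rel l xs k≤l))))
  part-b (enumIn xs A) k≤l ds sp _ = mk⇔ fwd bwd
    where
      T = enumSet Rel xs
      E = enumSet-agrees xs ds
      small : AtMost l T
      small = enumSet-AtMost Rel l xs k≤l
      faithful : ∀ X → V1' X → T ≐ M*X X → T ≐ vX M X
      faithful X v e = ≐-trans e (small-faithful sp X v (AtMost-resp (≐-sym e) small))
      fwd : vA M A (enumSet M xs) → M*A A T
      fwd p = M*A-complete A T (λ u t → enumSet-⊆D* xs ds u (proj₁ (E u) t)) faithful
                (vA-resp A (enumSet M xs) T (≐-sym E) p)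
      bwd : M*A A T → vA M A (enumSet M xs)
      bwd (inj₁ (q , _))               = vA-resp A T (enumSet M xs) E q
      bwd (inj₂ (inj₁ (X , v , e , q))) =
        vA-resp A (vX M X) (enumSet M xs) (≐-trans (≐-sym (faithful X v e)) E) q
      bwd (inj₂ (inj₂ (_ , q)))        = vA-resp A T (enumSet M xs) E q

  part-c : ∀ (ψ : Atom1) → All V1' (setVars1 ψ) → SizePreserving → Separating
    → sat1 M ψ ⇔ sat1 Rel ψ
  part-c (eq1 X Y) (vX' ∷ vY' ∷ []) sp sep =
    mk⇔ (M*X-resp X Y) (separated-injective sep X Y vX' vY')
  part-c (mem1 X A) (v ∷ []) sp sep = mk⇔ (λ q → inj₂ (inj₁ (X , v , ≐-refl , q))) bwd
    where
      bwd : M*A A (M*X X) → vA M A (vX M X)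
      bwd (inj₁ (_ , _ , ¬rep , _))      = ⊥-elim (¬rep (X , v , ≐-refl))
      bwd (inj₂ (inj₁ (Y , vY , e , q))) =
        vA-resp A (vX M Y) (vX M X) (≐-sym (separated-injective sep X Y v vY e)) q
      bwd (inj₂ (inj₂ (pow , q)))        =
        vA-resp A (M*X X) (vX M X) (small-faithful sp X v (proj₂ pow)) q

lemma3p2 : (lem : (P : Set) → Dec P)
  → {U : Set} (M : Interp U) → Is3LQST0 M
  → (D* : Subset U) → D* ⊆ dom M → (dec : ∀ u → Dec (D* u))
  → (d* : U) → D* d*
  → (V0' V1' : ℕ → Set) → (l : ℕ) → 0 < l
  → let open Relativize M D* dec d* V0' V1' l
        M* = Rel
    in
    -- (a)
    (∀ (ψ : Atom0) → All (λ x → D* (vx M x)) (vars0 ψ)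
       → sat0 M ψ ⇔ sat0 M* ψ)
    -- (b)
    × (∀ (ψ : Atom0') → enumLen ψ ≤ l
       → All (λ x → D* (vx M x)) (vars0' ψ)
       → (∀ X → V1' X
            → (AtMost l (vX M X) → vX M* X ≐ vX M X)
            × (¬ AtMost l (vX M X) → MoreThan l (vX M* X)))
       → All (λ X → ¬ V1' X → vX M* X ≐ vX M X) (setVars0' ψ)
       → sat0' M ψ ⇔ sat0' M* ψ)
    -- (c)
    × (∀ (ψ : Atom1) → All V1' (setVars1 ψ)
       → (∀ X → V1' X
            → (AtMost l (vX M X) → vX M* X ≐ vX M X)
            × (¬ AtMost l (vX M X) → MoreThan l (vX M* X)))
       → (∀ X Y → V1' X → V1' Y → ¬ (vX M X ≐ vX M Y)
            → ∃ λ u → (vX M X Δ vX M Y) u × D* u)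
       → sat1 M ψ ⇔ sat1 M* ψ)
lemma3p2 lem M is D* _ dec d* _ V0' V1' l _ = part-a , part-b , part-c
  where open Transfer lem M is D* dec d* V0' V1' l
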